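{- Let \[ H(x)=\sum_{n=0}^\infty\sum_{c=0}^n (x)_{n+1}\,x^n\,q^{c^2+c}\,x^{2c}\begin{bmatrix} n\\ c\end{bmatrix}. \] Then, as formal power series in $x$ and $q$, \[ H(x)=(qx)_\infty\sum_{c=0}^\infty\frac{q^{c^2+c}}{(qx)_c}x^{3c}+(1-x)\sum_{n=0}^\infty\sum_{c=0}^n\big((qx)_n-(qx)_\infty\big)x^n q^{c^2+c}x^{2c}\begin{bmatrix} n\\ c\end{bmatrix}. \]
   Context: Notation: $(x)_n=(x;q)_n=\prod_{i=1}^n(1-xq^{i-1})$, $(x)_\infty=\prod_{i\ge1}(1-xq^{i-1})$, and $\begin{bmatrix} n\\ c\end{bmatrix}=\frac{(q)_n}{(q)_c(q)_{n-c}}$ for $0\le c\le n$ and $0$ otherwise. -}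

module Defs where

open import Data.Nat using (ℕ; zero; suc; _∸_) renaming (_+_ to _+ℕ_; _*_ to _*ℕ_)
open import Data.Integer using (ℤ; 0ℤ; 1ℤ; _+_; _*_; _-_)
open import Relation.Binary.PropositionalEquality using (_≡_)
open import Data.Bool using (if_then_else_)
open import Data.Nat using (_≤ᵇ_)

-- Formal power series in two variables x, q with integer coefficients.
-- A series F is represented by its coefficient function:
--   F i j = coefficient of x^i q^j.

FPS : Set
FPS = ℕ → ℕ → ℤ

sumBelow : ℕ → (ℕ → ℤ) → ℤ
sumBelow zero    g = 0ℤ
sumBelow (suc n) g = sumBelow n g + g n

infixl 6 _⊕_ _⊖_
infixl 7 _⊛_
infixr 8 _^^_

_⊕_ : FPS → FPS → FPS
(f ⊕ g) i j = f i j + g i j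

_⊖_ : FPS → FPS → FPS
(f ⊖ g) i j = f i j - g i j

_⊛_ : FPS → FPS → FPS
(f ⊛ g) i j = sumBelow (suc i) λ a → sumBelow (suc j) λ b → f a b * g (i ∸ a) (j ∸ b)

zeroS : FPS
zeroS _ _ = 0ℤ

mono : ℕ → ℕ → FPS
mono a b i j = if (a ≤ᵇ i) Data.Bool.∧ (i ≤ᵇ a) Data.Bool.∧ (b ≤ᵇ j) Data.Bool.∧ (j ≤ᵇ b)
               then 1ℤ else 0ℤ

oneS xS qS : FPS
oneS = mono 0 0
xS   = mono 1 0
qS   = mono 0 1

_^^_ : FPS → ℕ → FPS
f ^^ zero  = oneS
f ^^ suc n = f ^^ n ⊛ f

fsum : ℕ → (ℕ → FPS) → FPS
fsum n g i j = sumBelow (suc n) λ c → g c i j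

fprod : ℕ → (ℕ → FPS) → FPS
fprod zero    g = oneS
fprod (suc n) g = fprod n g ⊛ g n

-- Infinite sum Σ_{n≥0} f n in the (x,q)-adic topology, for families in which
-- f n has total degree ≥ n (all families used below satisfy this): the
-- coefficient of x^i q^j only receives contributions from n ≤ i + j.
sumInf : (ℕ → FPS) → FPS
sumInf f i j = sumBelow (suc (i +ℕ j)) λ n → f n i j

-- 1/(1 - f) = Σ_{m≥0} f^m, for f without constant term.
invOneMinus : FPS → FPS
invOneMinus f = sumInf λ m → f ^^ m

qPoch : FPS → ℕ → FPS
qPoch a n = fprod n λ k → oneS ⊖ a ⊛ qS ^^ k

-- 1/(a)_n = Π_{k=1}^{n} 1/(1 - a q^{k-1})   (a without constant term)
qPochInv : FPS → ℕ → FPS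
qPochInv a n = fprod n λ k → invOneMinus (a ⊛ qS ^^ k)

-- (a)_∞ = Π_{k≥1} (1 - a q^{k-1}), for a without constant term and with
-- q ∣ a (here a = q x): the coefficient of x^i q^j is already determined by the
-- first i + j factors.
qPochInf : FPS → FPS
qPochInf a i j = qPoch a (i +ℕ j) i j

qbin : ℕ → ℕ → FPS
qbin n c = if c ≤ᵇ n
           then qPoch qS n ⊛ qPochInv qS c ⊛ qPochInv qS (n ∸ c)
           else zeroS

Hser : FPS
Hser = sumInf λ n → fsum n λ c →
  qPoch xS (suc n) ⊛ xS ^^ n ⊛ qS ^^ (c *ℕ c +ℕ c) ⊛ xS ^^ (2 *ℕ c) ⊛ qbin n c

qx : FPS
qx = qS ⊛ xS

RHSser : FPS
RHSser =
  qPochInf qx ⊛ (sumInf λ c → qS ^^ (c *ℕ c +ℕ c) ⊛ qPochInv qx c ⊛ xS ^^ (3 *ℕ c))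
  ⊕ (oneS ⊖ xS) ⊛ (sumInf λ n → fsum n λ c →
      (qPoch qx n ⊖ qPochInf qx) ⊛ xS ^^ n ⊛ qS ^^ (c *ℕ c +ℕ c) ⊛ xS ^^ (2 *ℕ c) ⊛ qbin n c)

-- Since (x)_(n+1) = (1 - x) (qx)_n, the left side is (1 - x) S₁ with S₁ = Σ_n Σ_c (qx)_n t(n,c),
-- where t(n,c) = q^(c²+c) x^(2c) x^n [n c] (summand n c below), and the second series on the right
-- is S₁ - (qx)_∞ S₀ with S₀ = Σ_n Σ_c t(n,c). So it remains to show
-- (1 - x) S₀ = Σ_c q^(c²+c) x^(3c) / (qx)_c. Summing over n first, this reduces to the generating
-- function F_c = Σ_n [n c] x^n of a column of Gaussian binomials (qbinGF), for which
-- (1 - x) F_c = x^c / (qx)_c follows by induction on c from the q-Pascal recurrence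
-- [n+1, c+1] = [n, c] + q^(c+1) [n, c+1], in the form (1 - x q^(c+1)) F_(c+1) = x F_c.
-- All series identities are proved coefficientwise; every infinite sum is a finite sum at each
-- coefficient because its n-th term has order at least n.

module Submission where

open import Defs
open import Data.Nat using (ℕ; zero; suc; _∸_; _≤_; _<_; _≤′_; ≤′-refl; ≤′-step; z≤n; s≤s; _≤ᵇ_)
  renaming (_+_ to _+ℕ_; _*_ to _*ℕ_)
import Data.Nat.Properties as ℕ
open import Data.Integer using (ℤ; 0ℤ; 1ℤ; _+_; _*_; _-_)
import Data.Integer.Properties as ℤ
open import Data.Integer.Tactic.RingSolver using (solve-∀)
open import Data.Nat.Tactic.RingSolver using () renaming (solve-∀ to ℕ-solve-∀)
open import Relation.Nullary using (yes; no; contradiction)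
open import Data.Bool using (true; false; T)
import Relation.Binary.Reasoning.Setoid as SetoidReasoning
open import Function using (_∘_)
open import Relation.Binary.PropositionalEquality hiding (J)
open import Relation.Binary using (Tri; tri<; tri≈; tri>)
open import Algebra.Bundles using (CommutativeMonoid)
import Algebra.Solver.CommutativeMonoid
open import Level using (0ℓ)
open import Data.Product using (_,_)
open import Data.Fin using (zero; suc)
open import Data.Vec using ([]; _∷_)

sumBelow-cong< : ∀ n {g h : ℕ → ℤ} → (∀ k → k < n → g k ≡ h k) → sumBelow n g ≡ sumBelow n h
sumBelow-cong< zero    eq = refl
sumBelow-cong< (suc n) eq = cong₂ _+_ (sumBelow-cong< n (λ k k<n → eq k (ℕ.m<n⇒m<1+n k<n))) (eq n ℕ.≤-refl)

sumBelow-cong : ∀ n {g h : ℕ → ℤ} → (∀ k → g k ≡ h k) → sumBelow n g ≡ sumBelow n h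
sumBelow-cong n eq = sumBelow-cong< n (λ k _ → eq k)

sumBelow-extend : ∀ {m n} {g : ℕ → ℤ} → m ≤′ n → (∀ k → m ≤ k → k < n → g k ≡ 0ℤ) →
                  sumBelow n g ≡ sumBelow m g
sumBelow-extend ≤′-refl vanish = refl
sumBelow-extend {m} {suc n} {g} (≤′-step m≤′n) vanish = begin
  sumBelow n g + g n   ≡⟨ cong₂ _+_ (sumBelow-extend m≤′n (λ k m≤k k<n → vanish k m≤k (ℕ.m<n⇒m<1+n k<n)))
                                    (vanish n (ℕ.≤′⇒≤ m≤′n) ℕ.≤-refl) ⟩
  sumBelow m g + 0ℤ    ≡⟨ ℤ.+-identityʳ _ ⟩
  sumBelow m g         ∎
  where open ≡-Reasoning

sumBelow-zero : ∀ n {g : ℕ → ℤ} → (∀ k → k < n → g k ≡ 0ℤ) → sumBelow n g ≡ 0ℤ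
sumBelow-zero n vanish = sumBelow-extend (ℕ.≤⇒≤′ z≤n) (λ k _ → vanish k)

sumBelow-+ : ∀ n (g h : ℕ → ℤ) → sumBelow n (λ k → g k + h k) ≡ sumBelow n g + sumBelow n h
sumBelow-+ zero    g h = refl
sumBelow-+ (suc n) g h = trans (cong (_+ (g n + h n)) (sumBelow-+ n g h)) (interchange (sumBelow n g) (sumBelow n h) (g n) (h n))
  where
  interchange : ∀ a b c d → (a + b) + (c + d) ≡ (a + c) + (b + d)
  interchange = solve-∀

sumBelow-- : ∀ n (g h : ℕ → ℤ) → sumBelow n (λ k → g k - h k) ≡ sumBelow n g - sumBelow n h
sumBelow-- zero    g h = refl
sumBelow-- (suc n) g h = trans (cong (_+ (g n - h n)) (sumBelow-- n g h)) (interchange (sumBelow n g) (sumBelow n h) (g n) (h n))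
  where
  interchange : ∀ a b c d → (a - b) + (c - d) ≡ (a + c) - (b + d)
  interchange = solve-∀

*-distribˡ-sumBelow : ∀ n x (g : ℕ → ℤ) → x * sumBelow n g ≡ sumBelow n (λ k → x * g k)
*-distribˡ-sumBelow zero    x g = ℤ.*-zeroʳ x
*-distribˡ-sumBelow (suc n) x g = trans (ℤ.*-distribˡ-+ x _ _) (cong (_+ x * g n) (*-distribˡ-sumBelow n x g))

sumBelow-suc : ∀ n (g : ℕ → ℤ) → sumBelow (suc n) g ≡ g 0 + sumBelow n (g ∘ suc)
sumBelow-suc zero    g = ℤ.+-comm 0ℤ (g 0)
sumBelow-suc (suc n) g = trans (cong (_+ g (suc n)) (sumBelow-suc n g)) (ℤ.+-assoc (g 0) _ _)

sumBelow-comm : ∀ m n (F : ℕ → ℕ → ℤ) →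
                sumBelow m (λ a → sumBelow n (F a)) ≡ sumBelow n (λ b → sumBelow m (λ a → F a b))
sumBelow-comm zero    n F = sym (sumBelow-zero n (λ _ _ → refl))
sumBelow-comm (suc m) n F = trans (cong (_+ sumBelow n (F m)) (sumBelow-comm m n F)) (sym (sumBelow-+ n _ _))

sumBelow-reverse : ∀ n (g : ℕ → ℤ) → sumBelow (suc n) g ≡ sumBelow (suc n) (λ a → g (n ∸ a))
sumBelow-reverse zero    g = refl
sumBelow-reverse (suc n) g = begin
  sumBelow (suc n) g + g (suc n)                   ≡⟨ cong (_+ g (suc n)) (sumBelow-reverse n g) ⟩
  sumBelow (suc n) (λ a → g (n ∸ a)) + g (suc n)   ≡⟨ ℤ.+-comm _ (g (suc n)) ⟩
  g (suc n) + sumBelow (suc n) (λ a → g (n ∸ a))   ≡⟨ sumBelow-suc (suc n) (λ a → g (suc n ∸ a)) ⟨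
  sumBelow (suc (suc n)) (λ a → g (suc n ∸ a))     ∎
  where open ≡-Reasoning

sumBelow-triangle : ∀ i (G : ℕ → ℕ → ℤ) →
  sumBelow (suc i) (λ a → sumBelow (suc a) (λ a' → G a' (a ∸ a'))) ≡
  sumBelow (suc i) (λ a' → sumBelow (suc (i ∸ a')) (G a'))
sumBelow-triangle zero    G = refl
sumBelow-triangle (suc i) G = begin
  sumBelow (suc (suc i)) (λ a → sumBelow (suc a) (λ a' → G a' (a ∸ a')))
    ≡⟨ sumBelow-cong (suc (suc i)) (λ a → sumBelow-suc a (λ a' → G a' (a ∸ a'))) ⟩
  sumBelow (suc (suc i)) (λ a → G 0 a + sumBelow a (λ a' → G (suc a') (a ∸ suc a')))
    ≡⟨ sumBelow-+ (suc (suc i)) _ _ ⟩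
  sumBelow (suc (suc i)) (G 0) + sumBelow (suc (suc i)) (λ a → sumBelow a (λ a' → G (suc a') (a ∸ suc a')))
    ≡⟨ cong (sumBelow (suc (suc i)) (G 0) +_) (trans (sumBelow-suc (suc i) _) (ℤ.+-identityˡ _)) ⟩
  sumBelow (suc (suc i)) (G 0) + sumBelow (suc i) (λ a → sumBelow (suc a) (λ a' → G (suc a') (a ∸ a')))
    ≡⟨ cong (sumBelow (suc (suc i)) (G 0) +_) (sumBelow-triangle i (G ∘ suc)) ⟩
  sumBelow (suc (suc i)) (G 0) + sumBelow (suc i) (λ a' → sumBelow (suc (i ∸ a')) (G (suc a')))
    ≡⟨ sumBelow-suc (suc i) _ ⟨
  sumBelow (suc (suc i)) (λ a' → sumBelow (suc (suc i ∸ a')) (G a')) ∎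
  where open ≡-Reasoning

*-distribʳ-sumBelow : ∀ n x (g : ℕ → ℤ) → sumBelow n g * x ≡ sumBelow n (λ k → g k * x)
*-distribʳ-sumBelow n x g = trans (ℤ.*-comm _ x)
  (trans (*-distribˡ-sumBelow n x g) (sumBelow-cong n (λ k → ℤ.*-comm x (g k))))

sumBelow-assoc : ∀ i (Φ : ℕ → ℕ → ℕ → ℤ) →
  sumBelow (suc i) (λ a → sumBelow (suc a) (λ a' → Φ a' (a ∸ a') (i ∸ a))) ≡
  sumBelow (suc i) (λ a' → sumBelow (suc (i ∸ a')) (λ c → Φ a' c (i ∸ a' ∸ c)))
sumBelow-assoc i Φ = begin
  sumBelow (suc i) (λ a → sumBelow (suc a) (λ a' → Φ a' (a ∸ a') (i ∸ a)))
    ≡⟨ sumBelow-cong (suc i) (λ a → sumBelow-cong< (suc a) (λ a' a'≤a →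
         cong (Φ a' (a ∸ a') ∘ (i ∸_)) (sym (ℕ.m+[n∸m]≡n (ℕ.≤-pred a'≤a))))) ⟩
  sumBelow (suc i) (λ a → sumBelow (suc a) (λ a' → G a' (a ∸ a')))
    ≡⟨ sumBelow-triangle i G ⟩
  sumBelow (suc i) (λ a' → sumBelow (suc (i ∸ a')) (G a'))
    ≡⟨ sumBelow-cong (suc i) (λ a' → sumBelow-cong (suc (i ∸ a')) (λ c →
         cong (Φ a' c) (sym (ℕ.∸-+-assoc i a' c)))) ⟩
  sumBelow (suc i) (λ a' → sumBelow (suc (i ∸ a')) (λ c → Φ a' c (i ∸ a' ∸ c))) ∎
  where
  open ≡-Reasoning
  G : ℕ → ℕ → ℤ
  G a' c = Φ a' c (i ∸ (a' +ℕ c))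

infix 4 _≋_
_≋_ : FPS → FPS → Set
f ≋ g = ∀ i j → f i j ≡ g i j

≋-refl : ∀ {f} → f ≋ f
≋-refl i j = refl

≋-sym : ∀ {f g} → f ≋ g → g ≋ f
≋-sym f≋g i j = sym (f≋g i j)

≋-trans : ∀ {f g h} → f ≋ g → g ≋ h → f ≋ h
≋-trans f≋g g≋h i j = trans (f≋g i j) (g≋h i j)

≡⇒≋ : ∀ {f g} → f ≡ g → f ≋ g
≡⇒≋ refl = ≋-refl

⊕-cong : ∀ {f f′ g g′} → f ≋ f′ → g ≋ g′ → f ⊕ g ≋ f′ ⊕ g′
⊕-cong f≋f′ g≋g′ i j = cong₂ _+_ (f≋f′ i j) (g≋g′ i j)

⊖-cong : ∀ {f f′ g g′} → f ≋ f′ → g ≋ g′ → f ⊖ g ≋ f′ ⊖ g′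
⊖-cong f≋f′ g≋g′ i j = cong₂ _-_ (f≋f′ i j) (g≋g′ i j)

⊕-congˡ : ∀ f {g g′} → g ≋ g′ → f ⊕ g ≋ f ⊕ g′
⊕-congˡ f g≋g′ = ⊕-cong (≋-refl {f}) g≋g′

⊖-congˡ : ∀ f {g g′} → g ≋ g′ → f ⊖ g ≋ f ⊖ g′
⊖-congˡ f g≋g′ = ⊖-cong (≋-refl {f}) g≋g′

⊖-congʳ : ∀ g {f f′} → f ≋ f′ → f ⊖ g ≋ f′ ⊖ g
⊖-congʳ g f≋f′ = ⊖-cong f≋f′ (≋-refl {g})

⊕-identityˡ : ∀ f → zeroS ⊕ f ≋ f
⊕-identityˡ f i j = ℤ.+-identityˡ (f i j)

⊕-identityʳ : ∀ f → f ⊕ zeroS ≋ f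
⊕-identityʳ f i j = ℤ.+-identityʳ (f i j)

[f⊕g]⊖g≋f : ∀ f g → (f ⊕ g) ⊖ g ≋ f
[f⊕g]⊖g≋f f g i j = cancel (f i j) (g i j)
  where
  cancel : ∀ a b → (a + b) - b ≡ a
  cancel = solve-∀

g⊕[f⊖g]≋f : ∀ f g → g ⊕ (f ⊖ g) ≋ f
g⊕[f⊖g]≋f f g i j = cancel (f i j) (g i j)
  where
  cancel : ∀ a b → b + (a - b) ≡ a
  cancel = solve-∀

[f⊖g]⊕[g⊖h]≋f⊖h : ∀ f g h → (f ⊖ g) ⊕ (g ⊖ h) ≋ f ⊖ h
[f⊖g]⊕[g⊖h]≋f⊖h f g h i j = telescope (f i j) (g i j) (h i j)
  where
  telescope : ∀ a b c → (a - b) + (b - c) ≡ a - c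
  telescope = solve-∀

⊛-cong : ∀ {f f′ g g′} → f ≋ f′ → g ≋ g′ → f ⊛ g ≋ f′ ⊛ g′
⊛-cong f≋f′ g≋g′ i j = sumBelow-cong (suc i) λ a → sumBelow-cong (suc j) λ b →
  cong₂ _*_ (f≋f′ a b) (g≋g′ (i ∸ a) (j ∸ b))

⊛-congʳ : ∀ {f f′} g → f ≋ f′ → f ⊛ g ≋ f′ ⊛ g
⊛-congʳ g f≋f′ = ⊛-cong f≋f′ (≋-refl {g})

⊛-congˡ : ∀ f {g g′} → g ≋ g′ → f ⊛ g ≋ f ⊛ g′
⊛-congˡ f g≋g′ = ⊛-cong (≋-refl {f}) g≋g′

⊛-comm : ∀ f g → f ⊛ g ≋ g ⊛ f
⊛-comm f g i j = begin
  sumBelow (suc i) (λ a → sumBelow (suc j) λ b → f a b * g (i ∸ a) (j ∸ b))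
    ≡⟨ sumBelow-reverse i _ ⟩
  sumBelow (suc i) (λ a → sumBelow (suc j) λ b → f (i ∸ a) b * g (i ∸ (i ∸ a)) (j ∸ b))
    ≡⟨ sumBelow-cong (suc i) (λ a → sumBelow-reverse j _) ⟩
  sumBelow (suc i) (λ a → sumBelow (suc j) λ b → f (i ∸ a) (j ∸ b) * g (i ∸ (i ∸ a)) (j ∸ (j ∸ b)))
    ≡⟨ sumBelow-cong< (suc i) (λ a a≤i → sumBelow-cong< (suc j) λ b b≤j →
         trans (ℤ.*-comm (f (i ∸ a) (j ∸ b)) _) (cong₂ (λ u v → g u v * f (i ∸ a) (j ∸ b))
           (ℕ.m∸[m∸n]≡n (ℕ.≤-pred a≤i)) (ℕ.m∸[m∸n]≡n (ℕ.≤-pred b≤j)))) ⟩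
  sumBelow (suc i) (λ a → sumBelow (suc j) λ b → g a b * f (i ∸ a) (j ∸ b)) ∎
  where open ≡-Reasoning

⊛-assoc : ∀ f g h → (f ⊛ g) ⊛ h ≋ f ⊛ (g ⊛ h)
⊛-assoc f g h i j = begin
  ((f ⊛ g) ⊛ h) i j
    ≡⟨ sumBelow-cong (suc i) (λ a → sumBelow-cong (suc j) λ b →
         trans (*-distribʳ-sumBelow (suc a) _ _) (sumBelow-cong (suc a) λ a′ →
         trans (*-distribʳ-sumBelow (suc b) _ _) (sumBelow-cong (suc b) λ b′ →
         ℤ.*-assoc (f a′ b′) _ _))) ⟩
  sumBelow (suc i) (λ a → sumBelow (suc j) λ b → sumBelow (suc a) λ a′ → sumBelow (suc b) λ b′ →
    F a′ b′ (a ∸ a′) (b ∸ b′) (i ∸ a) (j ∸ b))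
    ≡⟨ sumBelow-cong (suc i) (λ a → sumBelow-comm (suc j) (suc a) _) ⟩
  sumBelow (suc i) (λ a → sumBelow (suc a) λ a′ → sumBelow (suc j) λ b → sumBelow (suc b) λ b′ →
    F a′ b′ (a ∸ a′) (b ∸ b′) (i ∸ a) (j ∸ b))
    ≡⟨ sumBelow-assoc i (λ a′ c e → sumBelow (suc j) λ b → sumBelow (suc b) λ b′ →
         F a′ b′ c (b ∸ b′) e (j ∸ b)) ⟩
  sumBelow (suc i) (λ a′ → sumBelow (suc (i ∸ a′)) λ c → sumBelow (suc j) λ b → sumBelow (suc b) λ b′ →
    F a′ b′ c (b ∸ b′) (i ∸ a′ ∸ c) (j ∸ b))
    ≡⟨ sumBelow-cong (suc i) (λ a′ → sumBelow-cong (suc (i ∸ a′)) λ c →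
         sumBelow-assoc j (λ b′ d e → F a′ b′ c d (i ∸ a′ ∸ c) e)) ⟩
  sumBelow (suc i) (λ a′ → sumBelow (suc (i ∸ a′)) λ c → sumBelow (suc j) λ b′ → sumBelow (suc (j ∸ b′)) λ d →
    F a′ b′ c d (i ∸ a′ ∸ c) (j ∸ b′ ∸ d))
    ≡⟨ sumBelow-cong (suc i) (λ a′ → sumBelow-comm (suc (i ∸ a′)) (suc j) _) ⟩
  sumBelow (suc i) (λ a′ → sumBelow (suc j) λ b′ → sumBelow (suc (i ∸ a′)) λ c → sumBelow (suc (j ∸ b′)) λ d →
    F a′ b′ c d (i ∸ a′ ∸ c) (j ∸ b′ ∸ d))
    ≡⟨ sumBelow-cong (suc i) (λ a′ → sumBelow-cong (suc j) λ b′ → sym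
         (trans (*-distribˡ-sumBelow (suc (i ∸ a′)) (f a′ b′) _) (sumBelow-cong (suc (i ∸ a′)) λ c →
          *-distribˡ-sumBelow (suc (j ∸ b′)) (f a′ b′) _))) ⟩
  (f ⊛ (g ⊛ h)) i j ∎
  where
  open ≡-Reasoning
  F : ℕ → ℕ → ℕ → ℕ → ℕ → ℕ → ℤ
  F a b c d e e′ = f a b * (g c d * h e e′)

⊛-identityˡ : ∀ f → oneS ⊛ f ≋ f
⊛-identityˡ f i j = begin
  (oneS ⊛ f) i j
    ≡⟨ sumBelow-suc i _ ⟩
  sumBelow (suc j) (λ b → oneS 0 b * f i (j ∸ b))
    + sumBelow i (λ a → sumBelow (suc j) λ b → oneS (suc a) b * f (i ∸ suc a) (j ∸ b))
    ≡⟨ cong₂ _+_ (sumBelow-suc j _) (sumBelow-zero i (λ _ _ → sumBelow-zero (suc j) λ _ _ → refl)) ⟩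
  (1ℤ * f i j + sumBelow j (λ b → oneS 0 (suc b) * f i (j ∸ suc b))) + 0ℤ
    ≡⟨ cong (λ s → (1ℤ * f i j + s) + 0ℤ) (sumBelow-zero j (λ _ _ → refl)) ⟩
  (1ℤ * f i j + 0ℤ) + 0ℤ
    ≡⟨ trans (ℤ.+-identityʳ _) (trans (ℤ.+-identityʳ _) (ℤ.*-identityˡ _)) ⟩
  f i j ∎
  where open ≡-Reasoning

⊛-identityʳ : ∀ f → f ⊛ oneS ≋ f
⊛-identityʳ f = ≋-trans (⊛-comm f oneS) (⊛-identityˡ f)

⊛-zeroʳ : ∀ f → f ⊛ zeroS ≋ zeroS
⊛-zeroʳ f i j = sumBelow-zero (suc i) λ a _ → sumBelow-zero (suc j) λ b _ → ℤ.*-zeroʳ (f a b)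

⊛-unitʳ : ∀ f {u} → u ≋ oneS → f ≋ f ⊛ u
⊛-unitʳ f u≋1 = ≋-sym (≋-trans (⊛-congˡ f u≋1) (⊛-identityʳ f))

⊛-distribˡ-⊕ : ∀ h f g → h ⊛ (f ⊕ g) ≋ h ⊛ f ⊕ h ⊛ g
⊛-distribˡ-⊕ h f g i j =
  trans (sumBelow-cong (suc i) λ a →
           trans (sumBelow-cong (suc j) λ b → ℤ.*-distribˡ-+ (h a b) _ _) (sumBelow-+ (suc j) _ _))
        (sumBelow-+ (suc i) _ _)

⊛-distribˡ-⊖ : ∀ h f g → h ⊛ (f ⊖ g) ≋ h ⊛ f ⊖ h ⊛ g
⊛-distribˡ-⊖ h f g i j =
  trans (sumBelow-cong (suc i) λ a →
           trans (sumBelow-cong (suc j) λ b → distrib (h a b) _ _) (sumBelow-- (suc j) _ _))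
        (sumBelow-- (suc i) _ _)
  where
  distrib : ∀ x y z → x * (y - z) ≡ x * y - x * z
  distrib = solve-∀

⊛-distribʳ-⊖ : ∀ h f g → (f ⊖ g) ⊛ h ≋ f ⊛ h ⊖ g ⊛ h
⊛-distribʳ-⊖ h f g =
  ≋-trans (⊛-comm (f ⊖ g) h) (≋-trans (⊛-distribˡ-⊖ h f g) (⊖-cong (⊛-comm h f) (⊛-comm h g)))

⊛-commutativeMonoid : CommutativeMonoid 0ℓ 0ℓ
⊛-commutativeMonoid = record
  { Carrier = FPS
  ; _≈_     = _≋_
  ; _∙_     = _⊛_
  ; ε       = oneS
  ; isCommutativeMonoid = record
    { isMonoid = record
      { isSemigroup = record
        { isMagma  = record
          { isEquivalence = record { refl = ≋-refl ; sym = ≋-sym ; trans = ≋-trans }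
          ; ∙-cong        = ⊛-cong
          }
        ; assoc = ⊛-assoc
        }
      ; identity = ⊛-identityˡ , ⊛-identityʳ
      }
    ; comm = ⊛-comm
    }
  }

module ≈-Reasoning = SetoidReasoning (CommutativeMonoid.setoid ⊛-commutativeMonoid)

open Algebra.Solver.CommutativeMonoid ⊛-commutativeMonoid
  using (Expr; var) renaming (prove to ⊛-prove; _⊕_ to _∙_)

-- Solver variables usable at any arity. `prove` decides equality of normal forms; `solve … refl`
-- would instead make Agda unfold and compare the series themselves, which is very slow.
v₀ : ∀ {n} → Expr (1 +ℕ n)
v₀ = var zero
v₁ : ∀ {n} → Expr (2 +ℕ n)
v₁ = var (suc zero)
v₂ : ∀ {n} → Expr (3 +ℕ n)
v₂ = var (suc (suc zero))
v₃ : ∀ {n} → Expr (4 +ℕ n)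
v₃ = var (suc (suc (suc zero)))
v₄ : ∀ {n} → Expr (5 +ℕ n)
v₄ = var (suc (suc (suc (suc zero))))
v₅ : ∀ {n} → Expr (6 +ℕ n)
v₅ = var (suc (suc (suc (suc (suc zero)))))

-- Order and infinite sums

Order≥ : ℕ → FPS → Set
Order≥ m f = ∀ i j → i +ℕ j < m → f i j ≡ 0ℤ

Order≥-weaken : ∀ {m n f} → n ≤ m → Order≥ m f → Order≥ n f
Order≥-weaken n≤m ord i j i+j<n = ord i j (ℕ.<-≤-trans i+j<n n≤m)

Order≥-0 : ∀ f → Order≥ 0 f
Order≥-0 f i j ()

Order≥-1 : ∀ {f} → f 0 0 ≡ 0ℤ → Order≥ 1 f
Order≥-1 f₀₀≡0 zero    zero    _          = f₀₀≡0
Order≥-1 f₀₀≡0 zero    (suc j) (s≤s ())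
Order≥-1 f₀₀≡0 (suc i) j       (s≤s ())

Order≥-x : Order≥ 1 xS
Order≥-x = Order≥-1 refl

Order≥-q : Order≥ 1 qS
Order≥-q = Order≥-1 refl

Order≥-⊛ : ∀ {m n f g} → Order≥ m f → Order≥ n g → Order≥ (m +ℕ n) (f ⊛ g)
Order≥-⊛ {m} {n} {f} {g} ord-f ord-g i j i+j<m+n =
  sumBelow-zero (suc i) λ a a≤i → sumBelow-zero (suc j) λ b b≤j → vanish a b (ℕ.≤-pred a≤i) (ℕ.≤-pred b≤j)
  where
  vanish : ∀ a b → a ≤ i → b ≤ j → f a b * g (i ∸ a) (j ∸ b) ≡ 0ℤ
  vanish a b a≤i b≤j with a +ℕ b ℕ.<? m
  ... | yes a+b<m = trans (cong (_* g (i ∸ a) (j ∸ b)) (ord-f a b a+b<m)) (ℤ.*-zeroˡ (g (i ∸ a) (j ∸ b)))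
  ... | no  a+b≮m = trans (cong (f a b *_) (ord-g (i ∸ a) (j ∸ b) rest<n)) (ℤ.*-zeroʳ (f a b))
    where
    split : (a +ℕ b) +ℕ ((i ∸ a) +ℕ (j ∸ b)) ≡ i +ℕ j
    split = trans (interchange a b (i ∸ a) (j ∸ b)) (cong₂ _+ℕ_ (ℕ.m+[n∸m]≡n a≤i) (ℕ.m+[n∸m]≡n b≤j))
      where
      interchange : ∀ a b c d → (a +ℕ b) +ℕ (c +ℕ d) ≡ (a +ℕ c) +ℕ (b +ℕ d)
      interchange = ℕ-solve-∀
    rest<n : (i ∸ a) +ℕ (j ∸ b) < n
    rest<n = ℕ.+-cancelˡ-< m _ _ (ℕ.≤-<-trans
      (subst (m +ℕ ((i ∸ a) +ℕ (j ∸ b)) ≤_) split (ℕ.+-monoˡ-≤ _ (ℕ.≮⇒≥ a+b≮m))) i+j<m+n)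

Order≥-⊛ˡ : ∀ {m f} g → Order≥ m f → Order≥ m (f ⊛ g)
Order≥-⊛ˡ {m} g ord = Order≥-weaken (ℕ.≤-reflexive (sym (ℕ.+-identityʳ m))) (Order≥-⊛ ord (Order≥-0 g))

Order≥-^^ : ∀ {f} → Order≥ 1 f → ∀ n → Order≥ n (f ^^ n)
Order≥-^^ ord zero    = Order≥-0 oneS
Order≥-^^ ord (suc n) = Order≥-weaken (ℕ.≤-reflexive (ℕ.+-comm 1 n)) (Order≥-⊛ (Order≥-^^ ord n) ord)

Order≥-fsum : ∀ {m} n g → (∀ c → Order≥ m (g c)) → Order≥ m (fsum n g)
Order≥-fsum n g ord i j i+j<m = sumBelow-zero (suc n) λ c _ → ord c i j i+j<m

Summable : (ℕ → FPS) → Set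
Summable f = ∀ n → Order≥ n (f n)

sumInf-truncate : ∀ {f} → Summable f → ∀ {i j N} → i +ℕ j < N → sumInf f i j ≡ sumBelow N (λ n → f n i j)
sumInf-truncate ord i+j<N = sym (sumBelow-extend (ℕ.≤⇒≤′ i+j<N) (λ k i+j<k _ → ord k _ _ i+j<k))

sumInf-cong : ∀ {f g} → (∀ n → f n ≋ g n) → sumInf f ≋ sumInf g
sumInf-cong f≋g i j = sumBelow-cong (suc (i +ℕ j)) λ n → f≋g n i j

sumInf-⊖ : ∀ f g → sumInf (λ n → f n ⊖ g n) ≋ sumInf f ⊖ sumInf g
sumInf-⊖ f g i j = sumBelow-- (suc (i +ℕ j)) _ _

sumInf-⊕ : ∀ f g → sumInf (λ n → f n ⊕ g n) ≋ sumInf f ⊕ sumInf g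
sumInf-⊕ f g i j = sumBelow-+ (suc (i +ℕ j)) _ _

sumInf-suc : ∀ f → Summable f → sumInf f ≋ f 0 ⊕ sumInf (f ∘ suc)
sumInf-suc f ord i j = trans (sumBelow-suc (i +ℕ j) (λ n → f n i j))
  (cong (f 0 i j +_) (sym (sumBelow-extend (ℕ.≤⇒≤′ (ℕ.n≤1+n _)) λ n i+j≤n _ → ord (suc n) i j (s≤s i+j≤n))))

⊛-distribˡ-sumInf : ∀ k f → Summable f → k ⊛ sumInf f ≋ sumInf (λ n → k ⊛ f n)
⊛-distribˡ-sumInf k f ord i j = begin
  sumBelow (suc i) (λ a → sumBelow (suc j) λ b → k a b * sumInf f (i ∸ a) (j ∸ b))
    ≡⟨ sumBelow-cong (suc i) (λ a → sumBelow-cong (suc j) λ b → cong (k a b *_)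
         (sumInf-truncate ord (s≤s (ℕ.+-mono-≤ (ℕ.m∸n≤m i a) (ℕ.m∸n≤m j b))))) ⟩
  sumBelow (suc i) (λ a → sumBelow (suc j) λ b → k a b * sumBelow N (λ n → f n (i ∸ a) (j ∸ b)))
    ≡⟨ sumBelow-cong (suc i) (λ a → sumBelow-cong (suc j) λ b → *-distribˡ-sumBelow N (k a b) _) ⟩
  sumBelow (suc i) (λ a → sumBelow (suc j) λ b → sumBelow N λ n → k a b * f n (i ∸ a) (j ∸ b))
    ≡⟨ sumBelow-cong (suc i) (λ a → sumBelow-comm (suc j) N _) ⟩
  sumBelow (suc i) (λ a → sumBelow N λ n → sumBelow (suc j) λ b → k a b * f n (i ∸ a) (j ∸ b))
    ≡⟨ sumBelow-comm (suc i) N _ ⟩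
  sumInf (λ n → k ⊛ f n) i j ∎
  where
  open ≡-Reasoning
  N = suc (i +ℕ j)

fsum-cong : ∀ n {g h} → (∀ c → g c ≋ h c) → fsum n g ≋ fsum n h
fsum-cong n g≋h i j = sumBelow-cong (suc n) λ c → g≋h c i j

fsum-⊖ : ∀ n g h → fsum n (λ c → g c ⊖ h c) ≋ fsum n g ⊖ fsum n h
fsum-⊖ n g h i j = sumBelow-- (suc n) _ _

⊛-distribˡ-fsum : ∀ n k g → k ⊛ fsum n g ≋ fsum n (λ c → k ⊛ g c)
⊛-distribˡ-fsum n k g i j =
  trans (sumBelow-cong (suc i) λ a →
           trans (sumBelow-cong (suc j) λ b → *-distribˡ-sumBelow (suc n) (k a b) _)
                 (sumBelow-comm (suc j) (suc n) _))
        (sumBelow-comm (suc i) (suc n) _)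

sumInf-fsum-comm : ∀ (a : ℕ → ℕ → FPS) → (∀ n c → n < c → a n c ≋ zeroS) →
                   sumInf (λ n → fsum n (a n)) ≋ sumInf (λ c → sumInf (λ n → a n c))
sumInf-fsum-comm a upper i j =
  trans (sumBelow-cong< N λ n n<N → sym (sumBelow-extend (ℕ.≤⇒≤′ n<N) λ c n<c _ → upper n c n<c i j))
        (sumBelow-comm N N _)
  where N = suc (i +ℕ j)

oneMinus-⊛-invOneMinus : ∀ {f} → Order≥ 1 f → (oneS ⊖ f) ⊛ invOneMinus f ≋ oneS
oneMinus-⊛-invOneMinus {f} ord i j = begin
  ((oneS ⊖ f) ⊛ invOneMinus f) i j
    ≡⟨ ⊛-distribʳ-⊖ (invOneMinus f) oneS f i j ⟩
  (oneS ⊛ invOneMinus f) i j - (f ⊛ invOneMinus f) i j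
    ≡⟨ cong₂ _-_ (⊛-identityˡ (invOneMinus f) i j)
                 (trans (⊛-distribˡ-sumInf f (f ^^_) (Order≥-^^ ord) i j) (sumInf-cong (λ m → ⊛-comm f (f ^^ m)) i j)) ⟩
  invOneMinus f i j - sumInf (λ m → f ^^ suc m) i j
    ≡⟨ cong (_- sumInf (λ m → f ^^ suc m) i j) (sumInf-suc (f ^^_) (Order≥-^^ ord) i j) ⟩
  (oneS i j + sumInf (λ m → f ^^ suc m) i j) - sumInf (λ m → f ^^ suc m) i j
    ≡⟨ [f⊕g]⊖g≋f oneS (sumInf (λ m → f ^^ suc m)) i j ⟩
  oneS i j ∎
  where open ≡-Reasoning

^^-distribˡ-+-⊛ : ∀ f m n → f ^^ (m +ℕ n) ≋ f ^^ m ⊛ f ^^ n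
^^-distribˡ-+-⊛ f m zero    = ≋-trans (≡⇒≋ (cong (f ^^_) (ℕ.+-identityʳ m))) (≋-sym (⊛-identityʳ (f ^^ m)))
^^-distribˡ-+-⊛ f m (suc n) = begin
  f ^^ (m +ℕ suc n)       ≈⟨ ≡⇒≋ (cong (f ^^_) (ℕ.+-suc m n)) ⟩
  f ^^ (m +ℕ n) ⊛ f       ≈⟨ ⊛-congʳ f (^^-distribˡ-+-⊛ f m n) ⟩
  (f ^^ m ⊛ f ^^ n) ⊛ f   ≈⟨ ⊛-assoc (f ^^ m) (f ^^ n) f ⟩
  f ^^ m ⊛ f ^^ suc n     ∎
  where open ≈-Reasoning

fprod-cong : ∀ n {g h} → (∀ k → g k ≋ h k) → fprod n g ≋ fprod n h
fprod-cong zero    g≋h = ≋-refl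
fprod-cong (suc n) g≋h = ⊛-cong (fprod-cong n g≋h) (g≋h n)

fprod-suc : ∀ n g → fprod (suc n) g ≋ g 0 ⊛ fprod n (g ∘ suc)
fprod-suc zero    g = ≋-trans (⊛-identityˡ (g 0)) (≋-sym (⊛-identityʳ (g 0)))
fprod-suc (suc n) g = begin
  fprod (suc n) g ⊛ g (suc n)             ≈⟨ ⊛-congʳ (g (suc n)) (fprod-suc n g) ⟩
  (g 0 ⊛ fprod n (g ∘ suc)) ⊛ g (suc n)   ≈⟨ ⊛-assoc (g 0) (fprod n (g ∘ suc)) (g (suc n)) ⟩
  g 0 ⊛ fprod (suc n) (g ∘ suc)           ∎
  where open ≈-Reasoning

fprod-inverse : ∀ n {g h} → (∀ k → g k ⊛ h k ≋ oneS) → fprod n g ⊛ fprod n h ≋ oneS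
fprod-inverse zero    inv = ⊛-identityˡ oneS
fprod-inverse (suc n) {g} {h} inv = begin
  (fprod n g ⊛ g n) ⊛ (fprod n h ⊛ h n)   ≈⟨ interchange (fprod n g) (g n) (fprod n h) (h n) ⟩
  (fprod n g ⊛ fprod n h) ⊛ (g n ⊛ h n)   ≈⟨ ⊛-cong (fprod-inverse n inv) (inv n) ⟩
  oneS ⊛ oneS                             ≈⟨ ⊛-identityˡ oneS ⟩
  oneS                                    ∎
  where
  open ≈-Reasoning
  interchange : ∀ a b c d → (a ⊛ b) ⊛ (c ⊛ d) ≋ (a ⊛ c) ⊛ (b ⊛ d)
  interchange a b c d = ⊛-prove 4 ((v₀ ∙ v₁) ∙ (v₂ ∙ v₃)) ((v₀ ∙ v₂) ∙ (v₁ ∙ v₃)) (a ∷ b ∷ c ∷ d ∷ [])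

qPoch-⊛-qPochInv : ∀ {a} → Order≥ 1 a → ∀ n → qPoch a n ⊛ qPochInv a n ≋ oneS
qPoch-⊛-qPochInv ord n = fprod-inverse n λ k → oneMinus-⊛-invOneMinus (Order≥-⊛ˡ (qS ^^ k) ord)

qbin-≤ : ∀ {n c} → c ≤ n → qbin n c ≡ qPoch qS n ⊛ qPochInv qS c ⊛ qPochInv qS (n ∸ c)
qbin-≤ {n} {c} c≤n with c ≤ᵇ n | ℕ.≤⇒≤ᵇ c≤n
... | true | _ = refl

qbin-> : ∀ {n c} → n < c → qbin n c ≡ zeroS
qbin-> {n} {c} n<c with c ≤ᵇ n in eq
... | false = refl
... | true  = contradiction (ℕ.≤ᵇ⇒≤ c n (subst T (sym eq) _)) (ℕ.<⇒≱ n<c)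

⊛-qbin-> : ∀ f {n c} → n < c → f ⊛ qbin n c ≋ zeroS
⊛-qbin-> f {n} {c} n<c = ≋-trans (⊛-congˡ f (≡⇒≋ (qbin-> {n} {c} n<c))) (⊛-zeroʳ f)

qbin-0 : ∀ n → qbin n 0 ≋ oneS
qbin-0 n = begin
  qbin n 0                                    ≈⟨ ≡⇒≋ (qbin-≤ {n} z≤n) ⟩
  qPoch qS n ⊛ oneS ⊛ qPochInv qS n           ≈⟨ ⊛-congʳ (qPochInv qS n) (⊛-identityʳ (qPoch qS n)) ⟩
  qPoch qS n ⊛ qPochInv qS n                  ≈⟨ qPoch-⊛-qPochInv Order≥-q n ⟩
  oneS                                        ∎
  where open ≈-Reasoning

qbin-diag : ∀ n → qbin n n ≋ oneS
qbin-diag n = begin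
  qbin n n                                    ≈⟨ ≡⇒≋ (trans (qbin-≤ {n} ℕ.≤-refl) (cong (λ m → qPoch qS n ⊛ qPochInv qS n ⊛ qPochInv qS m) (ℕ.n∸n≡0 n))) ⟩
  qPoch qS n ⊛ qPochInv qS n ⊛ oneS           ≈⟨ ⊛-identityʳ (qPoch qS n ⊛ qPochInv qS n) ⟩
  qPoch qS n ⊛ qPochInv qS n                  ≈⟨ qPoch-⊛-qPochInv Order≥-q n ⟩
  oneS                                        ∎
  where open ≈-Reasoning

qFactor : ℕ → FPS
qFactor k = oneS ⊖ qS ⊛ qS ^^ k

qFactor-⊛-inverse : ∀ k → qFactor k ⊛ invOneMinus (qS ⊛ qS ^^ k) ≋ oneS
qFactor-⊛-inverse k = oneMinus-⊛-invOneMinus (Order≥-⊛ˡ (qS ^^ k) Order≥-q)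

qFactor-split : ∀ c d → qFactor (suc (c +ℕ d)) ≋ qFactor c ⊕ qS ^^ suc c ⊛ qFactor d
qFactor-split c d = ≋-sym (begin
  qFactor c ⊕ qS ^^ suc c ⊛ qFactor d
    ≈⟨ ⊕-congˡ (qFactor c) (⊛-distribˡ-⊖ (qS ^^ suc c) oneS (qS ⊛ qS ^^ d)) ⟩
  qFactor c ⊕ (qS ^^ suc c ⊛ oneS ⊖ qS ^^ suc c ⊛ (qS ⊛ qS ^^ d))
    ≈⟨ ⊕-congˡ (qFactor c) (⊖-cong (≋-trans (⊛-identityʳ (qS ^^ suc c)) (⊛-comm (qS ^^ c) qS)) q-powers) ⟩
  qFactor c ⊕ (qS ⊛ qS ^^ c ⊖ qS ⊛ qS ^^ suc (c +ℕ d))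
    ≈⟨ [f⊖g]⊕[g⊖h]≋f⊖h oneS (qS ⊛ qS ^^ c) (qS ⊛ qS ^^ suc (c +ℕ d)) ⟩
  qFactor (suc (c +ℕ d)) ∎)
  where
  open ≈-Reasoning
  q-powers : qS ^^ suc c ⊛ (qS ⊛ qS ^^ d) ≋ qS ⊛ qS ^^ suc (c +ℕ d)
  q-powers = begin
    (qS ^^ c ⊛ qS) ⊛ (qS ⊛ qS ^^ d)   ≈⟨ ⊛-prove 3 ((v₁ ∙ v₀) ∙ (v₀ ∙ v₂)) (v₀ ∙ ((v₁ ∙ v₂) ∙ v₀)) (qS ∷ qS ^^ c ∷ qS ^^ d ∷ []) ⟩
    qS ⊛ ((qS ^^ c ⊛ qS ^^ d) ⊛ qS)   ≈⟨ ⊛-congˡ qS (⊛-congʳ qS (≋-sym (^^-distribˡ-+-⊛ qS c d))) ⟩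
    qS ⊛ qS ^^ suc (c +ℕ d)           ∎

-- A named predicate: case analysis on a goal stated with the unfolded `_≋_` makes Agda normalise
-- the Gaussian binomials, which is very slow.
QPascal : ℕ → ℕ → Set
QPascal n c = qbin (suc n) (suc c) ≋ qbin n c ⊕ qS ^^ suc c ⊛ qbin n (suc c)

-- With n = c + d + 1, each of the three binomials is W times one of the factors 1 - q^(k+1) for
-- k = n, c, d, so the recurrence reduces to qFactor-split.
qbin-pascal-< : ∀ c d → QPascal (suc (c +ℕ d)) c
qbin-pascal-< c d = begin
  qbin (suc n) (suc c)                             ≈⟨ upper ⟩
  W ⊛ qFactor n                                    ≈⟨ ⊛-congˡ W (qFactor-split c d) ⟩
  W ⊛ (qFactor c ⊕ qS ^^ suc c ⊛ qFactor d)        ≈⟨ ⊛-distribˡ-⊕ W (qFactor c) (qS ^^ suc c ⊛ qFactor d) ⟩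
  W ⊛ qFactor c ⊕ W ⊛ (qS ^^ suc c ⊛ qFactor d)    ≈⟨ ⊕-cong (≋-sym lower-left)
                                                       (≋-trans (⊛-prove 3 (v₀ ∙ (v₁ ∙ v₂)) (v₁ ∙ (v₀ ∙ v₂)) (W ∷ qS ^^ suc c ∷ qFactor d ∷ []))
                                                                (⊛-congˡ (qS ^^ suc c) (≋-sym lower-right))) ⟩
  qbin n c ⊕ qS ^^ suc c ⊛ qbin n (suc c)          ∎
  where
  open ≈-Reasoning
  n = suc (c +ℕ d)
  A = qPoch qS n
  B = qPochInv qS c
  C = qPochInv qS d
  I = invOneMinus (qS ⊛ qS ^^ c)
  J = invOneMinus (qS ⊛ qS ^^ d)
  W = A ⊛ B ⊛ C ⊛ I ⊛ J
  W′ : Expr 6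
  W′ = ((((v₀ ∙ v₁) ∙ v₂) ∙ v₃) ∙ v₄) ∙ v₅

  c≤n : c ≤ n
  c≤n = ℕ.m≤n⇒m≤1+n (ℕ.m≤m+n c d)

  n∸c≡1+d : n ∸ c ≡ suc d
  n∸c≡1+d = trans (cong (_∸ c) (sym (ℕ.+-suc c d))) (ℕ.m+n∸m≡n c (suc d))

  upper : qbin (suc n) (suc c) ≋ W ⊛ qFactor n
  upper = begin
    qbin (suc n) (suc c)                               ≈⟨ ≡⇒≋ (qbin-≤ {suc n} {suc c} (s≤s c≤n)) ⟩
    qPoch qS (suc n) ⊛ (B ⊛ I) ⊛ qPochInv qS (n ∸ c)   ≈⟨ ⊛-congˡ (qPoch qS (suc n) ⊛ (B ⊛ I)) (≡⇒≋ (cong (qPochInv qS) n∸c≡1+d)) ⟩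
    (A ⊛ qFactor n) ⊛ (B ⊛ I) ⊛ (C ⊛ J)                ≈⟨ ⊛-prove 6 (((v₀ ∙ v₅) ∙ (v₁ ∙ v₃)) ∙ (v₂ ∙ v₄)) W′ (A ∷ B ∷ C ∷ I ∷ J ∷ qFactor n ∷ []) ⟩
    W ⊛ qFactor n                                      ∎

  lower-left : qbin n c ≋ W ⊛ qFactor c
  lower-left = begin
    qbin n c                                      ≈⟨ ≡⇒≋ (qbin-≤ {n} {c} c≤n) ⟩
    A ⊛ B ⊛ qPochInv qS (n ∸ c)                   ≈⟨ ⊛-congˡ (A ⊛ B) (≡⇒≋ (cong (qPochInv qS) n∸c≡1+d)) ⟩
    A ⊛ B ⊛ (C ⊛ J)                               ≈⟨ ⊛-unitʳ (A ⊛ B ⊛ (C ⊛ J)) (qFactor-⊛-inverse c) ⟩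
    (A ⊛ B ⊛ (C ⊛ J)) ⊛ (qFactor c ⊛ I)           ≈⟨ ⊛-prove 6 (((v₀ ∙ v₁) ∙ (v₂ ∙ v₄)) ∙ (v₅ ∙ v₃)) W′ (A ∷ B ∷ C ∷ I ∷ J ∷ qFactor c ∷ []) ⟩
    W ⊛ qFactor c                                 ∎

  lower-right : qbin n (suc c) ≋ W ⊛ qFactor d
  lower-right = begin
    qbin n (suc c)                                ≈⟨ ≡⇒≋ (qbin-≤ {n} {suc c} (s≤s (ℕ.m≤m+n c d))) ⟩
    A ⊛ (B ⊛ I) ⊛ qPochInv qS (n ∸ suc c)         ≈⟨ ⊛-congˡ (A ⊛ (B ⊛ I)) (≡⇒≋ (cong (qPochInv qS) (ℕ.m+n∸m≡n c d))) ⟩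
    A ⊛ (B ⊛ I) ⊛ C                               ≈⟨ ⊛-unitʳ (A ⊛ (B ⊛ I) ⊛ C) (qFactor-⊛-inverse d) ⟩
    (A ⊛ (B ⊛ I) ⊛ C) ⊛ (qFactor d ⊛ J)           ≈⟨ ⊛-prove 6 (((v₀ ∙ (v₁ ∙ v₃)) ∙ v₂) ∙ (v₅ ∙ v₄)) W′ (A ∷ B ∷ C ∷ I ∷ J ∷ qFactor d ∷ []) ⟩
    W ⊛ qFactor d                                 ∎

qbin-pascal : ∀ n c → QPascal n c
qbin-pascal n c = by-cases (ℕ.<-cmp c n)
  where
  open ≈-Reasoning
  by-cases : Tri (c < n) (c ≡ n) (n < c) → QPascal n c
  by-cases (tri< c<n _ _) = subst (λ m → QPascal m c) (ℕ.m+[n∸m]≡n c<n) (qbin-pascal-< c (n ∸ suc c))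
  by-cases (tri≈ _ refl _) = begin
    qbin (suc n) (suc n)                          ≈⟨ qbin-diag (suc n) ⟩
    oneS                                          ≈⟨ ⊕-identityʳ oneS ⟨
    oneS ⊕ zeroS                                  ≈⟨ ⊕-cong (≋-sym (qbin-diag n)) (≋-sym (⊛-qbin-> (qS ^^ suc n) {n} {suc n} (ℕ.n<1+n n))) ⟩
    qbin n n ⊕ qS ^^ suc n ⊛ qbin n (suc n)       ∎
  by-cases (tri> _ _ n<c) = begin
    qbin (suc n) (suc c)                          ≈⟨ ≡⇒≋ (qbin-> {suc n} {suc c} (s≤s n<c)) ⟩
    zeroS ⊕ zeroS                                 ≈⟨ ⊕-cong (≋-sym (≡⇒≋ (qbin-> {n} {c} n<c)))
                                                            (≋-sym (⊛-qbin-> (qS ^^ suc c) {n} {suc c} (ℕ.m<n⇒m<1+n n<c))) ⟩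
    qbin n c ⊕ qS ^^ suc c ⊛ qbin n (suc c)       ∎

-- The generating function of a column of Gaussian binomials

Summable-x^ : ∀ (g : ℕ → FPS) → Summable (λ n → xS ^^ n ⊛ g n)
Summable-x^ g n = Order≥-⊛ˡ (g n) (Order≥-^^ Order≥-x n)

x-⊛-q^suc : ∀ k → xS ⊛ qS ^^ suc k ≋ qx ⊛ qS ^^ k
x-⊛-q^suc k = ⊛-prove 3 (v₀ ∙ (v₁ ∙ v₂)) ((v₂ ∙ v₀) ∙ v₁) (xS ∷ qS ^^ k ∷ qS ∷ [])

qbinGF : ℕ → FPS
qbinGF c = sumInf (λ n → xS ^^ n ⊛ qbin n c)

qbinGF-suc : ∀ c → qbinGF (suc c) ≋ xS ⊛ qbinGF c ⊕ (xS ⊛ qS ^^ suc c) ⊛ qbinGF (suc c)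
qbinGF-suc c = begin
  qbinGF (suc c)
    ≈⟨ sumInf-suc (λ n → xS ^^ n ⊛ qbin n (suc c)) (Summable-x^ (λ n → qbin n (suc c))) ⟩
  xS ^^ 0 ⊛ qbin 0 (suc c) ⊕ sumInf (λ n → xS ^^ suc n ⊛ qbin (suc n) (suc c))
    ≈⟨ ⊕-cong (⊛-qbin-> (xS ^^ 0) {0} {suc c} (s≤s z≤n)) (sumInf-cong pascal-term) ⟩
  zeroS ⊕ sumInf (λ n → xS ⊛ (xS ^^ n ⊛ qbin n c) ⊕ y ⊛ (xS ^^ n ⊛ qbin n (suc c)))
    ≈⟨ ≋-trans (⊕-identityˡ (sumInf (λ n → xS ⊛ (xS ^^ n ⊛ qbin n c) ⊕ y ⊛ (xS ^^ n ⊛ qbin n (suc c))))) (sumInf-⊕ (λ n → xS ⊛ (xS ^^ n ⊛ qbin n c)) (λ n → y ⊛ (xS ^^ n ⊛ qbin n (suc c)))) ⟩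
  sumInf (λ n → xS ⊛ (xS ^^ n ⊛ qbin n c)) ⊕ sumInf (λ n → y ⊛ (xS ^^ n ⊛ qbin n (suc c)))
    ≈⟨ ⊕-cong (≋-sym (⊛-distribˡ-sumInf xS (λ n → xS ^^ n ⊛ qbin n c) (Summable-x^ (λ n → qbin n c))))
              (≋-sym (⊛-distribˡ-sumInf y (λ n → xS ^^ n ⊛ qbin n (suc c)) (Summable-x^ (λ n → qbin n (suc c))))) ⟩
  xS ⊛ qbinGF c ⊕ y ⊛ qbinGF (suc c) ∎
  where
  open ≈-Reasoning
  y = xS ⊛ qS ^^ suc c
  pascal-term : ∀ n → xS ^^ suc n ⊛ qbin (suc n) (suc c) ≋ xS ⊛ (xS ^^ n ⊛ qbin n c) ⊕ y ⊛ (xS ^^ n ⊛ qbin n (suc c))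
  pascal-term n = begin
    xS ^^ suc n ⊛ qbin (suc n) (suc c)
      ≈⟨ ⊛-congˡ (xS ^^ suc n) (qbin-pascal n c) ⟩
    xS ^^ suc n ⊛ (qbin n c ⊕ qS ^^ suc c ⊛ qbin n (suc c))
      ≈⟨ ⊛-distribˡ-⊕ (xS ^^ suc n) (qbin n c) (qS ^^ suc c ⊛ qbin n (suc c)) ⟩
    xS ^^ suc n ⊛ qbin n c ⊕ xS ^^ suc n ⊛ (qS ^^ suc c ⊛ qbin n (suc c))
      ≈⟨ ⊕-cong (⊛-prove 3 ((v₀ ∙ v₁) ∙ v₂) (v₁ ∙ (v₀ ∙ v₂)) (xS ^^ n ∷ xS ∷ qbin n c ∷ []))
                (⊛-prove 4 ((v₀ ∙ v₁) ∙ (v₂ ∙ v₃)) ((v₁ ∙ v₂) ∙ (v₀ ∙ v₃)) (xS ^^ n ∷ xS ∷ qS ^^ suc c ∷ qbin n (suc c) ∷ [])) ⟩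
    xS ⊛ (xS ^^ n ⊛ qbin n c) ⊕ y ⊛ (xS ^^ n ⊛ qbin n (suc c)) ∎

oneMinus-xq^suc-⊛-qbinGF : ∀ c → (oneS ⊖ xS ⊛ qS ^^ suc c) ⊛ qbinGF (suc c) ≋ xS ⊛ qbinGF c
oneMinus-xq^suc-⊛-qbinGF c = begin
  (oneS ⊖ y) ⊛ qbinGF (suc c)                         ≈⟨ ⊛-distribʳ-⊖ (qbinGF (suc c)) oneS y ⟩
  oneS ⊛ qbinGF (suc c) ⊖ y ⊛ qbinGF (suc c)          ≈⟨ ⊖-congʳ (y ⊛ qbinGF (suc c)) (≋-trans (⊛-identityˡ (qbinGF (suc c))) (qbinGF-suc c)) ⟩
  (xS ⊛ qbinGF c ⊕ y ⊛ qbinGF (suc c)) ⊖ y ⊛ qbinGF (suc c)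
                                                      ≈⟨ [f⊕g]⊖g≋f (xS ⊛ qbinGF c) (y ⊛ qbinGF (suc c)) ⟩
  xS ⊛ qbinGF c                                       ∎
  where
  open ≈-Reasoning
  y = xS ⊛ qS ^^ suc c

oneMinus-x-⊛-qbinGF : ∀ c → (oneS ⊖ xS) ⊛ qbinGF c ≋ xS ^^ c ⊛ qPochInv qx c
oneMinus-x-⊛-qbinGF zero = begin
  (oneS ⊖ xS) ⊛ qbinGF 0         ≈⟨ ⊛-congˡ (oneS ⊖ xS) (sumInf-cong (λ n → ≋-trans (⊛-congˡ (xS ^^ n) (qbin-0 n)) (⊛-identityʳ (xS ^^ n)))) ⟩
  (oneS ⊖ xS) ⊛ invOneMinus xS   ≈⟨ oneMinus-⊛-invOneMinus Order≥-x ⟩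
  oneS                           ≈⟨ ⊛-identityˡ oneS ⟨
  oneS ⊛ oneS                    ∎
  where open ≈-Reasoning
oneMinus-x-⊛-qbinGF (suc c) = begin
  (oneS ⊖ xS) ⊛ qbinGF (suc c)
    ≈⟨ ⊛-unitʳ ((oneS ⊖ xS) ⊛ qbinGF (suc c)) (oneMinus-⊛-invOneMinus (Order≥-⊛ˡ (qS ^^ c) (Order≥-⊛ˡ xS Order≥-q))) ⟩
  ((oneS ⊖ xS) ⊛ qbinGF (suc c)) ⊛ ((oneS ⊖ qx ⊛ qS ^^ c) ⊛ I)
    ≈⟨ ⊛-congˡ ((oneS ⊖ xS) ⊛ qbinGF (suc c)) (⊛-congʳ I (⊖-congˡ oneS (≋-sym (x-⊛-q^suc c)))) ⟩
  ((oneS ⊖ xS) ⊛ qbinGF (suc c)) ⊛ ((oneS ⊖ xS ⊛ qS ^^ suc c) ⊛ I)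
    ≈⟨ ⊛-prove 4 ((v₀ ∙ v₁) ∙ (v₂ ∙ v₃)) ((v₀ ∙ (v₂ ∙ v₁)) ∙ v₃) ((oneS ⊖ xS) ∷ qbinGF (suc c) ∷ (oneS ⊖ xS ⊛ qS ^^ suc c) ∷ I ∷ []) ⟩
  ((oneS ⊖ xS) ⊛ ((oneS ⊖ xS ⊛ qS ^^ suc c) ⊛ qbinGF (suc c))) ⊛ I
    ≈⟨ ⊛-congʳ I (⊛-congˡ (oneS ⊖ xS) (oneMinus-xq^suc-⊛-qbinGF c)) ⟩
  ((oneS ⊖ xS) ⊛ (xS ⊛ qbinGF c)) ⊛ I
    ≈⟨ ⊛-prove 4 ((v₀ ∙ (v₁ ∙ v₂)) ∙ v₃) ((v₁ ∙ (v₀ ∙ v₂)) ∙ v₃) ((oneS ⊖ xS) ∷ xS ∷ qbinGF c ∷ I ∷ []) ⟩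
  (xS ⊛ ((oneS ⊖ xS) ⊛ qbinGF c)) ⊛ I
    ≈⟨ ⊛-congʳ I (⊛-congˡ xS (oneMinus-x-⊛-qbinGF c)) ⟩
  (xS ⊛ (xS ^^ c ⊛ qPochInv qx c)) ⊛ I
    ≈⟨ ⊛-prove 4 ((v₀ ∙ (v₁ ∙ v₂)) ∙ v₃) ((v₁ ∙ v₀) ∙ (v₂ ∙ v₃)) (xS ∷ xS ^^ c ∷ qPochInv qx c ∷ I ∷ []) ⟩
  xS ^^ suc c ⊛ qPochInv qx (suc c) ∎
  where
  open ≈-Reasoning
  I = invOneMinus (qx ⊛ qS ^^ c)

weight : ℕ → FPS
weight c = qS ^^ (c *ℕ c +ℕ c) ⊛ xS ^^ (2 *ℕ c)

Order≥-weight : ∀ c → Order≥ c (weight c)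
Order≥-weight c = Order≥-weaken (ℕ.m≤m+n c (c +ℕ 0)) (Order≥-⊛ (Order≥-0 (qS ^^ (c *ℕ c +ℕ c))) (Order≥-^^ Order≥-x (2 *ℕ c)))

summand : ℕ → ℕ → FPS
summand n c = weight c ⊛ (xS ^^ n ⊛ qbin n c)

Order≥-summand : ∀ n c → Order≥ n (summand n c)
Order≥-summand n c = Order≥-⊛ (Order≥-0 (weight c)) (Summable-x^ (λ m → qbin m c) n)

summand-> : ∀ {n c} → n < c → summand n c ≋ zeroS
summand-> {n} {c} n<c = ≋-trans (⊛-congˡ (weight c) (⊛-qbin-> (xS ^^ n) {n} {c} n<c)) (⊛-zeroʳ (weight c))

⊛-summand : ∀ A n c → A ⊛ xS ^^ n ⊛ qS ^^ (c *ℕ c +ℕ c) ⊛ xS ^^ (2 *ℕ c) ⊛ qbin n c ≋ A ⊛ summand n c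
⊛-summand A n c = ⊛-prove 5 ((((v₀ ∙ v₁) ∙ v₂) ∙ v₃) ∙ v₄) (v₀ ∙ ((v₂ ∙ v₃) ∙ (v₁ ∙ v₄)))
                    (A ∷ xS ^^ n ∷ qS ^^ (c *ℕ c +ℕ c) ∷ xS ^^ (2 *ℕ c) ∷ qbin n c ∷ [])

sumInf-fsum-⊛ˡ : ∀ k (a : ℕ → ℕ → FPS) → (∀ n c → Order≥ n (a n c)) →
                 sumInf (λ n → fsum n (λ c → k ⊛ a n c)) ≋ k ⊛ sumInf (λ n → fsum n (a n))
sumInf-fsum-⊛ˡ k a ord = ≋-trans (sumInf-cong (λ n → ≋-sym (⊛-distribˡ-fsum n k (a n))))
  (≋-sym (⊛-distribˡ-sumInf k (λ n → fsum n (a n)) (λ n → Order≥-fsum n (a n) (ord n))))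

qPoch-x-suc : ∀ n → qPoch xS (suc n) ≋ (oneS ⊖ xS) ⊛ qPoch qx n
qPoch-x-suc n = ≋-trans (fprod-suc n (λ k → oneS ⊖ xS ⊛ qS ^^ k))
  (⊛-cong (⊖-congˡ oneS (⊛-identityʳ xS)) (fprod-cong n (λ k → ⊖-congˡ oneS (x-⊛-q^suc k))))

S₀ S₁ cubicSeries differenceSeries : FPS
S₀ = sumInf λ n → fsum n (summand n)
S₁ = sumInf λ n → fsum n λ c → qPoch qx n ⊛ summand n c
cubicSeries = sumInf λ c → qS ^^ (c *ℕ c +ℕ c) ⊛ qPochInv qx c ⊛ xS ^^ (3 *ℕ c)
differenceSeries = sumInf λ n → fsum n λ c →
  (qPoch qx n ⊖ qPochInf qx) ⊛ xS ^^ n ⊛ qS ^^ (c *ℕ c +ℕ c) ⊛ xS ^^ (2 *ℕ c) ⊛ qbin n c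

Hser≋oneMinus-x-⊛-S₁ : Hser ≋ (oneS ⊖ xS) ⊛ S₁
Hser≋oneMinus-x-⊛-S₁ = begin
  Hser
    ≈⟨ sumInf-cong (λ n → fsum-cong n (λ c → ≋-trans (⊛-summand (qPoch xS (suc n)) n c)
         (≋-trans (⊛-congʳ (summand n c) (qPoch-x-suc n)) (⊛-assoc (oneS ⊖ xS) (qPoch qx n) (summand n c))))) ⟩
  sumInf (λ n → fsum n (λ c → (oneS ⊖ xS) ⊛ (qPoch qx n ⊛ summand n c)))
    ≈⟨ sumInf-fsum-⊛ˡ (oneS ⊖ xS) (λ n c → qPoch qx n ⊛ summand n c)
         (λ n c → Order≥-⊛ (Order≥-0 (qPoch qx n)) (Order≥-summand n c)) ⟩
  (oneS ⊖ xS) ⊛ S₁ ∎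
  where open ≈-Reasoning

differenceSeries≋ : differenceSeries ≋ S₁ ⊖ qPochInf qx ⊛ S₀
differenceSeries≋ = begin
  differenceSeries
    ≈⟨ sumInf-cong (λ n → fsum-cong n (λ c → ≋-trans (⊛-summand (qPoch qx n ⊖ qPochInf qx) n c)
         (⊛-distribʳ-⊖ (summand n c) (qPoch qx n) (qPochInf qx)))) ⟩
  sumInf (λ n → fsum n (λ c → qPoch qx n ⊛ summand n c ⊖ qPochInf qx ⊛ summand n c))
    ≈⟨ sumInf-cong (λ n → fsum-⊖ n (λ c → qPoch qx n ⊛ summand n c) (λ c → qPochInf qx ⊛ summand n c)) ⟩
  sumInf (λ n → fsum n (λ c → qPoch qx n ⊛ summand n c) ⊖ fsum n (λ c → qPochInf qx ⊛ summand n c))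
    ≈⟨ sumInf-⊖ (λ n → fsum n (λ c → qPoch qx n ⊛ summand n c)) (λ n → fsum n (λ c → qPochInf qx ⊛ summand n c)) ⟩
  S₁ ⊖ sumInf (λ n → fsum n (λ c → qPochInf qx ⊛ summand n c))
    ≈⟨ ⊖-congˡ S₁ (sumInf-fsum-⊛ˡ (qPochInf qx) summand Order≥-summand) ⟩
  S₁ ⊖ qPochInf qx ⊛ S₀ ∎
  where open ≈-Reasoning

oneMinus-x-⊛-S₀ : (oneS ⊖ xS) ⊛ S₀ ≋ cubicSeries
oneMinus-x-⊛-S₀ = begin
  (oneS ⊖ xS) ⊛ S₀
    ≈⟨ ⊛-congˡ (oneS ⊖ xS) (sumInf-fsum-comm summand (λ n c → summand-> {n} {c})) ⟩
  (oneS ⊖ xS) ⊛ sumInf (λ c → sumInf (λ n → weight c ⊛ (xS ^^ n ⊛ qbin n c)))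
    ≈⟨ ⊛-congˡ (oneS ⊖ xS) (sumInf-cong (λ c → ≋-sym (⊛-distribˡ-sumInf (weight c) (λ n → xS ^^ n ⊛ qbin n c) (Summable-x^ (λ n → qbin n c))))) ⟩
  (oneS ⊖ xS) ⊛ sumInf (λ c → weight c ⊛ qbinGF c)
    ≈⟨ ⊛-distribˡ-sumInf (oneS ⊖ xS) (λ c → weight c ⊛ qbinGF c) (λ c → Order≥-⊛ˡ (qbinGF c) (Order≥-weight c)) ⟩
  sumInf (λ c → (oneS ⊖ xS) ⊛ (weight c ⊛ qbinGF c))
    ≈⟨ sumInf-cong term ⟩
  cubicSeries ∎
  where
  open ≈-Reasoning
  triple-split : ∀ c → 2 *ℕ c +ℕ c ≡ 3 *ℕ c
  triple-split = ℕ-solve-∀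
  term : ∀ c → (oneS ⊖ xS) ⊛ (weight c ⊛ qbinGF c) ≋ qS ^^ (c *ℕ c +ℕ c) ⊛ qPochInv qx c ⊛ xS ^^ (3 *ℕ c)
  term c = begin
    (oneS ⊖ xS) ⊛ (weight c ⊛ qbinGF c)
      ≈⟨ ⊛-prove 3 (v₀ ∙ (v₁ ∙ v₂)) (v₁ ∙ (v₀ ∙ v₂)) ((oneS ⊖ xS) ∷ weight c ∷ qbinGF c ∷ []) ⟩
    weight c ⊛ ((oneS ⊖ xS) ⊛ qbinGF c)
      ≈⟨ ⊛-congˡ (weight c) (oneMinus-x-⊛-qbinGF c) ⟩
    (qS ^^ (c *ℕ c +ℕ c) ⊛ xS ^^ (2 *ℕ c)) ⊛ (xS ^^ c ⊛ qPochInv qx c)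
      ≈⟨ ⊛-prove 4 ((v₀ ∙ v₁) ∙ (v₂ ∙ v₃)) ((v₀ ∙ v₃) ∙ (v₁ ∙ v₂)) (qS ^^ (c *ℕ c +ℕ c) ∷ xS ^^ (2 *ℕ c) ∷ xS ^^ c ∷ qPochInv qx c ∷ []) ⟩
    qS ^^ (c *ℕ c +ℕ c) ⊛ qPochInv qx c ⊛ (xS ^^ (2 *ℕ c) ⊛ xS ^^ c)
      ≈⟨ ⊛-congˡ (qS ^^ (c *ℕ c +ℕ c) ⊛ qPochInv qx c)
           (≋-trans (≋-sym (^^-distribˡ-+-⊛ xS (2 *ℕ c) c)) (≡⇒≋ (cong (xS ^^_) (triple-split c)))) ⟩
    qS ^^ (c *ℕ c +ℕ c) ⊛ qPochInv qx c ⊛ xS ^^ (3 *ℕ c) ∎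

oneMinus-x-⊛-differenceSeries : (oneS ⊖ xS) ⊛ differenceSeries ≋ (oneS ⊖ xS) ⊛ S₁ ⊖ qPochInf qx ⊛ cubicSeries
oneMinus-x-⊛-differenceSeries = begin
  (oneS ⊖ xS) ⊛ differenceSeries
    ≈⟨ ⊛-congˡ (oneS ⊖ xS) differenceSeries≋ ⟩
  (oneS ⊖ xS) ⊛ (S₁ ⊖ qPochInf qx ⊛ S₀)
    ≈⟨ ⊛-distribˡ-⊖ (oneS ⊖ xS) S₁ (qPochInf qx ⊛ S₀) ⟩
  (oneS ⊖ xS) ⊛ S₁ ⊖ (oneS ⊖ xS) ⊛ (qPochInf qx ⊛ S₀)
    ≈⟨ ⊖-congˡ ((oneS ⊖ xS) ⊛ S₁) (⊛-prove 3 (v₀ ∙ (v₁ ∙ v₂)) (v₁ ∙ (v₀ ∙ v₂)) ((oneS ⊖ xS) ∷ qPochInf qx ∷ S₀ ∷ [])) ⟩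
  (oneS ⊖ xS) ⊛ S₁ ⊖ qPochInf qx ⊛ ((oneS ⊖ xS) ⊛ S₀)
    ≈⟨ ⊖-congˡ ((oneS ⊖ xS) ⊛ S₁) (⊛-congˡ (qPochInf qx) oneMinus-x-⊛-S₀) ⟩
  (oneS ⊖ xS) ⊛ S₁ ⊖ qPochInf qx ⊛ cubicSeries ∎
  where open ≈-Reasoning

lemma2p2 : (i j : ℕ) → Hser i j ≡ RHSser i j
lemma2p2 = begin
  Hser                                      ≈⟨ Hser≋oneMinus-x-⊛-S₁ ⟩
  (oneS ⊖ xS) ⊛ S₁                          ≈⟨ g⊕[f⊖g]≋f ((oneS ⊖ xS) ⊛ S₁) P∞Σ ⟨
  P∞Σ ⊕ ((oneS ⊖ xS) ⊛ S₁ ⊖ P∞Σ)            ≈⟨ ⊕-congˡ P∞Σ (≋-sym oneMinus-x-⊛-differenceSeries) ⟩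
  RHSser                                    ∎
  where
  open ≈-Reasoning
  P∞Σ = qPochInf qx ⊛ cubicSeries
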